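{- Suppose the jobs have agreeable deadlines, and run the Greedy algorithm. For each time $\tau$ at which Greedy executes batches, let $\mathcal{X}_\tau$ be the set of batches executed at $\tau$ and let $I_\tau$ be the interval from the earliest release time of any job in a batch of $\mathcal{X}_\tau$ to the latest deadline of any job in a batch of $\mathcal{X}_\tau$. Then every point in time lies in at most two of the intervals $I_\tau$.
   Context: Setting: machine types $k$ with capacity $B_k\in\mathbb{Z}_{\ge1}$ and cost $c_k\ge1$, unlimited machines of each type. Unit-length jobs $j$ arrive online with integer release time $r_j$ and integer deadline $d_j\ge r_j$, revealed at time $r_j$. A batch $X$ is a set of jobs $J(X)$ with type $t(X)$ and execution time $\tau(X)$, requiring $|J(X)|\le B_{t(X)}$ and $r_j\le\tau(X)\le d_j$ for $j\in J(X)$. Jobs have agreeable deadlines if $r_j<r_{j'}$ implies $d_j\le d_{j'}$. Greedy algorithm: maintain a set $W$ of waiting jobs, initially empty. For $\tau=1,\dots,T$: add to $W$ all jobs with release time $\tau$; if some job in $W$ has deadline $\tau$, then compute a minimum-cost multiset of machine types whose total capacity is at least $|W|$, fill these machines with the jobs of $W$ (forming the batches $\mathcal{X}_\tau$, all executed at time $\tau$), and set $W\leftarrow\emptyset$. -}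

module Defs where

open import Data.Nat using (ℕ; zero; suc; _+_; _≤_; _<_; _≡ᵇ_)
open import Data.Bool using (Bool; true; false; _∧_; _∨_; not)
open import Data.Fin using (Fin)
open import Data.List using (List; []; _∷_; map; length; filter; allFin; concatMap)
open import Data.Bool.ListAction using (any)
open import Data.Nat.ListAction using (sum)
open import Data.List.Membership.Propositional using (_∈_)
open import Data.List.Relation.Unary.All using (All)
open import Data.List.Relation.Binary.Permutation.Propositional using (_↭_)
open import Data.Product using (Σ; ∃; _×_; _,_)
open import Relation.Binary.PropositionalEquality using (_≡_; _≢_)
open import Relation.Nullary using (¬_)
open import Relation.Nullary.Decidable using (does)
open import Data.Bool.Properties using (T?)

record MachineTypes (m : ℕ) : Set where
  field
    B    : Fin m → ℕ
    c    : Fin m → ℕ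
    B≥1  : ∀ k → 1 ≤ B k
    c≥1  : ∀ k → 1 ≤ c k

-- n unit-length jobs with integer release times r j and deadlines d j ≥ r j.
record Jobs (n : ℕ) : Set where
  field
    r    : Fin n → ℕ
    d    : Fin n → ℕ
    r≤d  : ∀ j → r j ≤ d j

Agreeable : ∀ {n} → Jobs n → Set
Agreeable J = ∀ j j' → Jobs.r J j < Jobs.r J j' → Jobs.d J j ≤ Jobs.d J j'

-- The waiting set of Greedy at time τ, after adding the jobs released at τ
-- (and before the possible flush at τ); and whether Greedy flushes at τ
-- (i.e. some waiting job has deadline τ).
module Greedy {n : ℕ} (J : Jobs n) where
  open Jobs J

  W       : ℕ → Fin n → Bool
  flush   : ℕ → Bool

  W zero j    = r j ≡ᵇ zero
  W (suc τ) j = (r j ≡ᵇ suc τ) ∨ (W τ j ∧ not (flush τ))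

  flush τ = any (λ j → W τ j ∧ (d j ≡ᵇ τ)) (allFin n)

  Wlist : ℕ → List (Fin n)
  Wlist τ = filter (λ j → T? (W τ j)) (allFin n)

record Batch (m n : ℕ) : Set where
  constructor batch
  field
    type  : Fin m
    jobs  : List (Fin n)
    time  : ℕ

module _ {m : ℕ} (M : MachineTypes m) where
  open MachineTypes M

  capacity : List (Fin m) → ℕ
  capacity ks = sum (map B ks)

  cost : List (Fin m) → ℕ
  cost ks = sum (map c ks)

  MinCost : ℕ → List (Fin m) → Set
  MinCost w ks = w ≤ capacity ks × (∀ ks' → w ≤ capacity ks' → cost ks ≤ cost ks')

  record GreedyRun {n : ℕ} (J : Jobs n) (X : ℕ → List (Batch m n)) : Set where
    open Greedy J
    field
      atFlush : ∀ τ → flush τ ≡ true →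
        MinCost (length (Wlist τ)) (map Batch.type (X τ))
        × concatMap Batch.jobs (X τ) ↭ Wlist τ
        × All (λ X → length (Batch.jobs X) ≤ B (Batch.type X) × Batch.time X ≡ τ) (X τ)
      notFlush : ∀ τ → flush τ ≡ false → X τ ≡ []

-- t lies in I_τ = [min release of a job in a batch of Xτ, max deadline of a
-- job in a batch of Xτ]; unfolded: some such job is released at or before t
-- and some such job has deadline at or after t.
InInterval : ∀ {m n} → Jobs n → List (Batch m n) → ℕ → Set
InInterval J Xτ t =
  (∃ λ j → j ∈ concatMap Batch.jobs Xτ × Jobs.r J j ≤ t)
  × (∃ λ j → j ∈ concatMap Batch.jobs Xτ × t ≤ Jobs.d J j)

-- A job waiting at a flush time τ was released after every earlier flush σ,
-- hence strictly later than every job executed at σ. Since τ is a flush, some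
-- waiting job has deadline τ, so agreeable deadlines bound every deadline in a
-- batch executed at σ by τ: I_σ ends by τ. Every job executed after τ was
-- released after τ, so I_τ' starts after τ for all later τ'. Thus I_τ₁ and
-- I_τ₃ are disjoint as soon as some execution time τ₂ lies between them.
module Submission where

open import Defs
open import Data.Nat using (ℕ; zero; suc; _≤_; _<_; z≤n; s≤s)
open import Data.Nat.Properties
  using (≤-refl; ≤-trans; ≤-<-trans; <-≤-trans; <-irrefl; n≤1+n; m≤n⇒m<n∨m≡n; ≡ᵇ⇒≡)
open import Data.Bool using (true; false; T)
open import Data.Bool.Properties using (T?; T-≡; T-∧; T-∨; T-not-≡)
open import Data.List using (List; []; allFin; concatMap)
open import Data.List.Relation.Unary.Any using (satisfied)
open import Data.List.Relation.Unary.Any.Properties using (any⁻)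
open import Data.List.Membership.Propositional using (_∈_)
open import Data.List.Membership.Propositional.Properties using (∈-filter⁻)
open import Data.List.Relation.Binary.Permutation.Propositional.Properties using (∈-resp-↭)
open import Data.Product using (_×_; _,_; ∃; proj₂)
open import Data.Sum using (_⊎_; inj₁; inj₂)
open import Data.Empty using (⊥-elim)
open import Function using (Equivalence)
open import Relation.Binary.PropositionalEquality using (_≡_; _≢_; refl; subst)
open import Relation.Nullary using (¬_)

open Equivalence using (to)

module GreedyProperties {n : ℕ} (J : Jobs n) where
  open Jobs J
  open Greedy J

  waiting-suc : ∀ {τ j} → T (W (suc τ) j) →
    r j ≡ suc τ ⊎ (T (W τ j) × flush τ ≡ false)
  waiting-suc {τ} {j} w with to T-∨ w
  ... | inj₁ released = inj₁ (≡ᵇ⇒≡ (r j) (suc τ) released)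
  ... | inj₂ kept with to T-∧ kept
  ...   | w′ , notFlushed = inj₂ (w′ , to T-not-≡ notFlushed)

  waiting⇒released : ∀ τ {j} → T (W τ j) → r j ≤ τ
  waiting⇒released zero {j} w rewrite ≡ᵇ⇒≡ (r j) 0 w = z≤n
  waiting⇒released (suc τ) w with waiting-suc w
  ... | inj₁ r≡ rewrite r≡ = ≤-refl
  ... | inj₂ (w′ , _) = ≤-trans (waiting⇒released τ w′) (n≤1+n τ)

  waiting⇒released-after-flush : ∀ τ {j σ} → T (W τ j) → σ < τ →
    T (flush σ) → σ < r j
  waiting⇒released-after-flush (suc τ) w (s≤s σ≤τ) f with waiting-suc w
  ... | inj₁ r≡ rewrite r≡ = s≤s σ≤τ
  ... | inj₂ (w′ , noFlush) with m≤n⇒m<n∨m≡n σ≤τ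
  ...   | inj₁ σ<τ = waiting⇒released-after-flush τ w′ σ<τ f
  ...   | inj₂ refl = ⊥-elim (subst T noFlush f)

  flush⇒due-job : ∀ τ → T (flush τ) → ∃ λ j → T (W τ j) × d j ≡ τ
  flush⇒due-job τ f with satisfied (any⁻ _ (allFin n) f)
  ... | j , wd with to T-∧ wd
  ...   | w , due = j , w , ≡ᵇ⇒≡ (d j) τ due

  waiting-deadline≤next-flush : Agreeable J → ∀ {σ τ j} → σ < τ →
    T (W σ j) → T (flush σ) → T (flush τ) → d j ≤ τ
  waiting-deadline≤next-flush agreeable {σ} {τ} {j} σ<τ w fσ fτ
    with flush⇒due-job τ fτ
  ... | k , wk , dk≡τ = subst (d j ≤_) dk≡τ (agreeable j k rj<rk)
    where
    rj<rk : r j < r k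
    rj<rk = ≤-<-trans (waiting⇒released σ w)
                      (waiting⇒released-after-flush τ wk σ<τ fσ)

module GreedyRunProperties {m n : ℕ} {M : MachineTypes m} {J : Jobs n}
  {X : ℕ → List (Batch m n)} (run : GreedyRun M J X) where
  open Greedy J
  open GreedyRun run

  executed⇒flush : ∀ τ → X τ ≢ [] → T (flush τ)
  executed⇒flush τ ne with flush τ in eq
  ... | true = _
  ... | false = ne (notFlush τ eq)

  executed⇒waiting : ∀ τ → (ne : X τ ≢ []) → ∀ {j} →
    j ∈ concatMap Batch.jobs (X τ) → T (W τ j)
  executed⇒waiting τ ne j∈ with atFlush τ (to T-≡ (executed⇒flush τ ne))
  ... | _ , jobs↭W , _ = proj₂ (∈-filter⁻ (λ j → T? (W τ j)) {xs = allFin n} (∈-resp-↭ jobs↭W j∈))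

lemma1 : ∀ {m n} (M : MachineTypes m) (J : Jobs n) → Agreeable J →
    (X : ℕ → List (Batch m n)) → GreedyRun M J X →
    ∀ (t τ₁ τ₂ τ₃ : ℕ) → τ₁ < τ₂ → τ₂ < τ₃ →
    X τ₁ ≢ [] → X τ₂ ≢ [] → X τ₃ ≢ [] →
    ¬ (InInterval J (X τ₁) t × InInterval J (X τ₂) t × InInterval J (X τ₃) t)
lemma1 M J agreeable X run t τ₁ τ₂ τ₃ τ₁<τ₂ τ₂<τ₃ ne₁ ne₂ ne₃
  ((_ , j₁ , j₁∈ , t≤d₁) , _ , (j₃ , j₃∈ , r₃≤t) , _) =
  <-irrefl refl (≤-<-trans t≤d₁ (≤-<-trans d₁≤τ₂ (<-≤-trans τ₂<r₃ r₃≤t)))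
  where
  open GreedyProperties J
  open GreedyRunProperties run

  d₁≤τ₂ : Jobs.d J j₁ ≤ τ₂
  d₁≤τ₂ = waiting-deadline≤next-flush agreeable τ₁<τ₂
    (executed⇒waiting τ₁ ne₁ j₁∈) (executed⇒flush τ₁ ne₁) (executed⇒flush τ₂ ne₂)

  τ₂<r₃ : τ₂ < Jobs.r J j₃
  τ₂<r₃ = waiting⇒released-after-flush τ₃ (executed⇒waiting τ₃ ne₃ j₃∈)
    τ₂<τ₃ (executed⇒flush τ₂ ne₂)
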